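{- Let $P$ be a poset, $\prec$ an auxiliary relation on $P$ and $A\subseteq P$. Then: (1) $A^{\downarrow\prec}\cup(P\setminus A)^{\uparrow\prec}=P$. (2) If moreover $A$ is an upper set, then $A^{\downarrow\prec}\cap(P\setminus A)^{\uparrow\prec}=\emptyset$; so $A^{\downarrow\prec}$ and $(P\setminus A)^{\uparrow\prec}$ partition $P$.
   Context: For a poset $(P,\le)$, $\mathord{\downarrow}X=\{x\mid\exists y\in X,\ x\le y\}$; $A$ is upper if $x\in A$, $x\le y$ imply $y\in A$. An auxiliary relation on $P$ is a binary relation $\prec$ such that: $x\prec y$ implies $x\le y$; $u\le x\prec y\le z$ implies $u\prec z$; if $P$ has a least element $\bot$ then $\bot\prec x$ for all $x$. Write $s_\prec(x)=\{y\mid y\prec x\}$. $A^{\downarrow\prec}=\{x\in A\mid s_\prec(x)\cap A\ne\emptyset\}$, $A^{\uparrow\prec}=\{x\in P\mid s_\prec(x)\subseteq\mathord{\downarrow}A\}$. -}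

module Defs where

open import Level using (Level; _⊔_)
open import Data.Product using (Σ; _×_; ∃; _,_)
open import Relation.Unary using (Pred; _∈_; ∁)
open import Relation.Binary.Core using (Rel)
open import Relation.Binary.Bundles using (Poset)

module _ {c ℓ₁ ℓ₂ : Level} (P : Poset c ℓ₁ ℓ₂) where
  open Poset P renaming (Carrier to Pt)

  ↓_ : ∀ {a} → Pred Pt a → Pred Pt (c ⊔ ℓ₂ ⊔ a)
  ↓ X = λ x → ∃ λ y → X y × x ≤ y

  IsUpper : ∀ {a} → Pred Pt a → Set (c ⊔ ℓ₂ ⊔ a)
  IsUpper A = ∀ {x y} → A x → x ≤ y → A y

  IsLeast : Pt → Set (c ⊔ ℓ₂)
  IsLeast b = ∀ x → b ≤ x

  record IsAuxiliary {ℓ₃} (_≺_ : Rel Pt ℓ₃) : Set (c ⊔ ℓ₂ ⊔ ℓ₃) where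
    field
      ≺⇒≤   : ∀ {x y} → x ≺ y → x ≤ y
      ≤≺≤⇒≺ : ∀ {u x y z} → u ≤ x → x ≺ y → y ≤ z → u ≺ z
      least≺ : ∀ b → IsLeast b → ∀ x → b ≺ x

  module _ {ℓ₃} (_≺_ : Rel Pt ℓ₃) where
    s : Pt → Pred Pt ℓ₃
    s x = λ y → y ≺ x

    _↓≺ : ∀ {a} → Pred Pt a → Pred Pt (c ⊔ ℓ₃ ⊔ a)
    (A ↓≺) x = A x × (∃ λ y → y ≺ x × A y)

    _↑≺ : ∀ {a} → Pred Pt a → Pred Pt (c ⊔ ℓ₂ ⊔ ℓ₃ ⊔ a)
    (A ↑≺) x = ∀ y → y ≺ x → (↓ A) y

-- Given x ∉ A↓≺ and y ≺ x, the point y lies below a point outside A: y itself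
-- when y ∉ A, and x when y ∈ A, since then x ∉ A (else y would witness x ∈ A↓≺).
-- Conversely, for upper A, a witness y ≺ x in A cannot lie below a point outside A.

module Submission where

open import Defs
open import Level using (_⊔_; Lift; lift; lower)
open import Data.Product using (_×_; _,_)
open import Data.Sum using (_⊎_; inj₁; inj₂)
open import Relation.Nullary using (¬_; Dec; yes; no)
open import Relation.Unary using (Pred; _∈_; _∉_; ∁)
open import Relation.Binary.Core using (Rel)
open import Relation.Binary.Bundles using (Poset)
open import Axiom.ExcludedMiddle using (ExcludedMiddle)

module _ {c ℓ₁ ℓ₂ ℓ₃} (P : Poset c ℓ₁ ℓ₂) (_≺_ : Rel (Poset.Carrier P) ℓ₃) where
  open Poset P renaming (Carrier to Pt)

  ∉↓≺⇒∈∁↑≺ : (∀ {x y} → x ≺ y → x ≤ y) → ∀ {a} {A : Pred Pt a}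
           → (∀ y → Dec (y ∈ A)) → ∀ {x} → x ∉ _↓≺ P _≺_ A → x ∈ _↑≺ P _≺_ (∁ A)
  ∉↓≺⇒∈∁↑≺ ≺⇒≤ A? {x} x∉A↓≺ y y≺x with A? y
  ... | no  y∉A = y , y∉A , refl
  ... | yes y∈A = x , (λ x∈A → x∉A↓≺ (x∈A , y , y≺x , y∈A)) , ≺⇒≤ y≺x

  ↓≺⊎∁↑≺ : (∀ {x y} → x ≺ y → x ≤ y) → ∀ {a} {A : Pred Pt a}
         → (∀ y → Dec (y ∈ A)) → (∀ x → Dec (x ∈ _↓≺ P _≺_ A))
         → ∀ x → x ∈ _↓≺ P _≺_ A ⊎ x ∈ _↑≺ P _≺_ (∁ A)
  ↓≺⊎∁↑≺ ≺⇒≤ A? A↓≺? x with A↓≺? x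
  ... | yes x∈A↓≺ = inj₁ x∈A↓≺
  ... | no  x∉A↓≺ = inj₂ (∉↓≺⇒∈∁↑≺ ≺⇒≤ A? x∉A↓≺)

  upper⇒↓≺∩∁↑≺-disjoint : ∀ {a} {A : Pred Pt a} → IsUpper P A
                        → ∀ x → ¬ (x ∈ _↓≺ P _≺_ A × x ∈ _↑≺ P _≺_ (∁ A))
  upper⇒↓≺∩∁↑≺-disjoint upper x ((_ , y , y≺x , y∈A) , x∈∁A↑≺)
    with x∈∁A↑≺ y y≺x
  ... | z , z∉A , y≤z = z∉A (upper y∈A y≤z)

decide : ∀ {ℓ ℓ′} → ExcludedMiddle (ℓ ⊔ ℓ′) → (X : Set ℓ) → Dec X
decide {ℓ′ = ℓ′} em X with em {Lift ℓ′ X}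
... | yes x = yes (lower x)
... | no ¬x = no (λ x → ¬x (lift x))

theorem3p8 : ∀ {c ℓ₁ ℓ₂ ℓ₃ a} (P : Poset c ℓ₁ ℓ₂) (_≺_ : Rel (Poset.Carrier P) ℓ₃)
    → IsAuxiliary P _≺_ → (A : Pred (Poset.Carrier P) a)
    → (ExcludedMiddle (c ⊔ ℓ₂ ⊔ ℓ₃ ⊔ a) → ∀ x → x ∈ _↓≺ P _≺_ A ⊎ x ∈ _↑≺ P _≺_ (∁ A))
    × (IsUpper P A → ∀ x → ¬ (x ∈ _↓≺ P _≺_ A × x ∈ _↑≺ P _≺_ (∁ A)))
theorem3p8 {c} {ℓ₂ = ℓ₂} {ℓ₃} {a} P _≺_ aux A =
    (λ em → ↓≺⊎∁↑≺ P _≺_ ≺⇒≤ (λ y → decide {ℓ′ = c ⊔ ℓ₂ ⊔ ℓ₃} em (y ∈ A))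
                              (λ x → decide {ℓ′ = ℓ₂} em (x ∈ _↓≺ P _≺_ A)))
  , upper⇒↓≺∩∁↑≺-disjoint P _≺_
  where open IsAuxiliary aux
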